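{- Let $n\ge3$ be odd and $D_{2n}=\langle a,b\mid a^n=b^2=1,\ bab=a^{ -1}\rangle$. Then no Cayley graph $X(D_{2n},\{a^k,a^{ -k},ba^i\})$ with $a^k\ne a^{ -k}$ is isomorphic to a Cayley graph $X(D_{2n},\{ba^{k_1},ba^{k_2},ba^{k_3}\})$ with $k_1,k_2,k_3\in\mathbb{Z}_n$ distinct.
   Context: The Cayley graph $X(G,S)$ ($1\notin S$, $S=S^{ -1}$) has vertex set $G$ with $g\sim h$ iff $hg^{ -1}\in S$. -}

module Defs where

open import Data.Nat using (ℕ; _+_; _∸_; NonZero)
open import Data.Nat.DivMod using (_mod_)
open import Data.Fin using (Fin; toℕ)
open import Data.Bool using (Bool; true; false; _xor_)
open import Data.Product using (_×_; _,_; Σ)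
open import Data.Sum using (_⊎_)
open import Relation.Binary.PropositionalEquality using (_≡_)
open import Function.Bundles using (_⤖_; _⇔_; Bijection)
open import Level using (0ℓ)

module _ (n : ℕ) .{{_ : NonZero n}} where

  _⊕_ : Fin n → Fin n → Fin n
  i ⊕ j = (toℕ i + toℕ j) mod n

  ⊖_ : Fin n → Fin n
  ⊖ i = (n ∸ toℕ i) mod n

  -- The dihedral group D_{2n} = ⟨a,b | aⁿ = b² = 1, bab = a⁻¹⟩.
  -- The element (e , i) stands for bᵉ aⁱ  (e = true means the factor b is present).
  D : Set
  D = Bool × Fin n

  -- bᵉ aⁱ · bᶠ aʲ = b^(e+f) a^((-1)ᶠ i + j), since aⁱ b = b a⁻ⁱ.
  mul : D → D → D
  mul (e , i) (false , j) = (e xor false , i ⊕ j)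
  mul (e , i) (true  , j) = (e xor true  , (⊖ i) ⊕ j)

  -- (bᵉ aⁱ)⁻¹ : a⁻ⁱ if e = false, and b aⁱ if e = true (reflections are involutions).
  inv : D → D
  inv (false , i) = (false , ⊖ i)
  inv (true  , i) = (true  , i)

  a^ : Fin n → D
  a^ k = (false , k)

  ba^ : Fin n → D
  ba^ i = (true , i)

  Adj : (D → Set) → D → D → Set
  Adj S g h = S (mul h (inv g))

  CayleyIso : (D → Set) → (D → Set) → Set
  CayleyIso S T = Σ (D ⤖ D) λ φ →
    ∀ g h → Adj S g h ⇔ Adj T (Bijection.to φ g) (Bijection.to φ h)

  S₁ : Fin n → Fin n → D → Set
  S₁ k i x = x ≡ a^ k ⊎ x ≡ a^ (⊖ k) ⊎ x ≡ ba^ i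

  S₂ : Fin n → Fin n → Fin n → D → Set
  S₂ k₁ k₂ k₃ x = x ≡ ba^ k₁ ⊎ x ≡ ba^ k₂ ⊎ x ≡ ba^ k₃

module Submission where

-- X(D_{2n}, {b a^{k₁}, b a^{k₂}, b a^{k₃}}) is bipartite: every connection element is a
-- reflection, so each edge joins a rotation to a reflection. In X(D_{2n}, {aᵏ, a⁻ᵏ, b aⁱ})
-- the rotations 1, aᵏ, a²ᵏ, …, aⁿᵏ = 1 form a closed walk of odd length n. An isomorphism
-- would pull the bipartition back to a proper 2-colouring of the second graph, which no
-- odd closed walk admits.

open import Defs
open import Data.Nat using (ℕ; NonZero; _≤_; zero; suc; _+_; _*_; _∸_; _%_; _/_; s≤s)
open import Data.Nat.Properties using (+-comm; +-assoc; +-identityʳ; *-comm; m+[n∸m]≡n; <⇒≤)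
open import Data.Nat.DivMod
  using (_mod_; %-distribˡ-+; m%n%n≡m%n; [m+n]%n≡m%n; [m+kn]%n≡m%n; m<n⇒m%n≡m; m%n<n; m≡m%n+[m/n]*n)
open import Data.Nat.Divisibility using (_∣_; divides)
open import Data.Nat.GeneralisedArithmetic using (iterate)
open import Data.Fin using (Fin; toℕ)
open import Data.Fin.Properties using (toℕ-injective; toℕ-fromℕ<; toℕ<n)
open import Data.Bool using (Bool; true; false; not)
open import Data.Bool.Properties using (not-involutive; not-¬)
open import Data.Product using (_,_; proj₁)
open import Data.Sum using (inj₁; inj₂)
open import Data.Empty using (⊥-elim)
open import Function.Bundles using (Bijection; Equivalence)
open import Relation.Nullary using (¬_)
open import Relation.Binary.PropositionalEquality
  using (_≡_; _≢_; refl; cong; cong₂; subst; module ≡-Reasoning)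

open ≡-Reasoning

odd⇒≡1+2q : ∀ n → ¬ (2 ∣ n) → n ≡ suc (n / 2 * 2)
odd⇒≡1+2q n 2∤n with n % 2 | m≡m%n+[m/n]*n n 2 | m%n<n n 2
... | 0           | n≡2q   | _               = ⊥-elim (2∤n (divides (n / 2) n≡2q))
... | 1           | n≡1+2q | _               = n≡1+2q
... | suc (suc _) | _      | s≤s (s≤s ())

[m%d+n]%d≡[m+n]%d : ∀ m n d .{{_ : NonZero d}} → (m % d + n) % d ≡ (m + n) % d
[m%d+n]%d≡[m+n]%d m n d = begin
  (m % d + n) % d           ≡⟨ %-distribˡ-+ (m % d) n d ⟩
  (m % d % d + n % d) % d   ≡⟨ cong (λ r → (r + n % d) % d) (m%n%n≡m%n m d) ⟩
  (m % d + n % d) % d       ≡⟨ %-distribˡ-+ m n d ⟨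
  (m + n) % d               ∎

module _ {V : Set} (_∼_ : V → V → Set) (colour : V → Bool)
         (proper : ∀ {u v} → u ∼ v → colour v ≡ not (colour u))
         (s : V → V) (step : ∀ v → v ∼ s v) where

  colour-iterate-even : ∀ q v → colour (iterate s v (q * 2)) ≡ colour v
  colour-iterate-even zero    v = refl
  colour-iterate-even (suc q) v = begin
    colour (iterate s (s (s v)) (q * 2))  ≡⟨ colour-iterate-even q (s (s v)) ⟩
    colour (s (s v))                      ≡⟨ proper (step (s v)) ⟩
    not (colour (s v))                    ≡⟨ cong not (proper (step v)) ⟩
    not (not (colour v))                  ≡⟨ not-involutive (colour v) ⟩
    colour v                              ∎

  iterate-odd-not-closed : ∀ q v → iterate s v (suc (q * 2)) ≢ v
  iterate-odd-not-closed q v closed = not-¬ refl (begin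
    colour v                              ≡⟨ cong colour closed ⟨
    colour (iterate s (s v) (q * 2))      ≡⟨ colour-iterate-even q (s v) ⟩
    colour (s v)                          ≡⟨ proper (step v) ⟩
    not (colour v)                        ∎)

module _ {n : ℕ} .{{_ : NonZero n}} where

  private
    _+ₙ_ : Fin n → Fin n → Fin n
    _+ₙ_ = _⊕_ n

    -ₙ_ : Fin n → Fin n
    -ₙ_ = ⊖_ n

  toℕ-⊕ : ∀ i j → toℕ (i +ₙ j) ≡ (toℕ i + toℕ j) % n
  toℕ-⊕ i j = toℕ-fromℕ< _

  toℕ-⊖ : ∀ i → toℕ (-ₙ i) ≡ (n ∸ toℕ i) % n
  toℕ-⊖ i = toℕ-fromℕ< _

  toℕ-%-id : ∀ (i : Fin n) → toℕ i % n ≡ toℕ i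
  toℕ-%-id i = m<n⇒m%n≡m (toℕ<n i)

  ⊕-⊖-cancel : ∀ x k → (x +ₙ k) +ₙ (-ₙ x) ≡ k
  ⊕-⊖-cancel x k = toℕ-injective (begin
    toℕ ((x +ₙ k) +ₙ (-ₙ x))                   ≡⟨ toℕ-⊕ (x +ₙ k) (-ₙ x) ⟩
    (toℕ (x +ₙ k) + toℕ (-ₙ x)) % n            ≡⟨ cong₂ (λ a b → (a + b) % n) (toℕ-⊕ x k) (toℕ-⊖ x) ⟩
    ((toℕ x + toℕ k) % n + (n ∸ toℕ x) % n) % n ≡⟨ %-distribˡ-+ (toℕ x + toℕ k) (n ∸ toℕ x) n ⟨
    (toℕ x + toℕ k + (n ∸ toℕ x)) % n          ≡⟨ cong (_% n) rearrange ⟩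
    (toℕ k + n) % n                            ≡⟨ [m+n]%n≡m%n (toℕ k) n ⟩
    toℕ k % n                                  ≡⟨ toℕ-%-id k ⟩
    toℕ k                                      ∎)
    where
    rearrange : toℕ x + toℕ k + (n ∸ toℕ x) ≡ toℕ k + n
    rearrange = begin
      toℕ x + toℕ k + (n ∸ toℕ x)   ≡⟨ cong (_+ (n ∸ toℕ x)) (+-comm (toℕ x) (toℕ k)) ⟩
      toℕ k + toℕ x + (n ∸ toℕ x)   ≡⟨ +-assoc (toℕ k) (toℕ x) (n ∸ toℕ x) ⟩
      toℕ k + (toℕ x + (n ∸ toℕ x)) ≡⟨ cong (toℕ k +_) (m+[n∸m]≡n (<⇒≤ (toℕ<n x))) ⟩
      toℕ k + n                     ∎

  toℕ-iterate-⊕ : ∀ k j x → toℕ (iterate (_+ₙ k) x j) ≡ (toℕ x + j * toℕ k) % n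
  toℕ-iterate-⊕ k zero    x = begin
    toℕ x              ≡⟨ toℕ-%-id x ⟨
    toℕ x % n          ≡⟨ cong (_% n) (+-identityʳ (toℕ x)) ⟨
    (toℕ x + 0) % n    ∎
  toℕ-iterate-⊕ k (suc j) x = begin
    toℕ (iterate (_+ₙ k) (x +ₙ k) j)     ≡⟨ toℕ-iterate-⊕ k j (x +ₙ k) ⟩
    (toℕ (x +ₙ k) + j * toℕ k) % n        ≡⟨ cong (λ r → (r + j * toℕ k) % n) (toℕ-⊕ x k) ⟩
    ((toℕ x + toℕ k) % n + j * toℕ k) % n ≡⟨ [m%d+n]%d≡[m+n]%d (toℕ x + toℕ k) (j * toℕ k) n ⟩
    (toℕ x + toℕ k + j * toℕ k) % n       ≡⟨ cong (_% n) (+-assoc (toℕ x) (toℕ k) (j * toℕ k)) ⟩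
    (toℕ x + suc j * toℕ k) % n           ∎

  iterate-⊕-n : ∀ k x → iterate (_+ₙ k) x n ≡ x
  iterate-⊕-n k x = toℕ-injective (begin
    toℕ (iterate (_+ₙ k) x n)   ≡⟨ toℕ-iterate-⊕ k n x ⟩
    (toℕ x + n * toℕ k) % n     ≡⟨ cong (λ m → (toℕ x + m) % n) (*-comm n (toℕ k)) ⟩
    (toℕ x + toℕ k * n) % n     ≡⟨ [m+kn]%n≡m%n (toℕ x) (toℕ k) n ⟩
    toℕ x % n                   ≡⟨ toℕ-%-id x ⟩
    toℕ x                       ∎)

  adj-reflection⇒side-flips : ∀ g h → proj₁ (mul n h (inv n g)) ≡ true → proj₁ h ≡ not (proj₁ g)
  adj-reflection⇒side-flips (false , _) (false , _) ()
  adj-reflection⇒side-flips (false , _) (true  , _) _ = refl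
  adj-reflection⇒side-flips (true  , _) (false , _) _ = refl
  adj-reflection⇒side-flips (true  , _) (true  , _) ()

  S₂-reflection : ∀ k₁ k₂ k₃ x → S₂ n k₁ k₂ k₃ x → proj₁ x ≡ true
  S₂-reflection k₁ k₂ k₃ x (inj₁ refl)          = refl
  S₂-reflection k₁ k₂ k₃ x (inj₂ (inj₁ refl))   = refl
  S₂-reflection k₁ k₂ k₃ x (inj₂ (inj₂ refl))   = refl

  S₁-rotation-step : ∀ k i x → Adj n (S₁ n k i) (a^ n x) (a^ n (x +ₙ k))
  S₁-rotation-step k i x = inj₁ (cong (false ,_) (⊕-⊖-cancel x k))

theorem2p3 : (n : ℕ) .{{_ : NonZero n}} → 3 ≤ n → ¬ (2 ∣ n) →
    (k i : Fin n) → a^ n k ≢ a^ n (⊖_ n k) →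
    (k₁ k₂ k₃ : Fin n) → k₁ ≢ k₂ → k₁ ≢ k₃ → k₂ ≢ k₃ →
    ¬ CayleyIso n (S₁ n k i) (S₂ n k₁ k₂ k₃)
theorem2p3 n _ 2∤n k i _ k₁ k₂ k₃ _ _ _ (φ , preserves) =
  iterate-odd-not-closed rotationAdj colour proper rotate (S₁-rotation-step k i) (n / 2) start closed
  where
  rotationAdj : Fin n → Fin n → Set
  rotationAdj x y = Adj n (S₁ n k i) (a^ n x) (a^ n y)

  colour : Fin n → Bool
  colour x = proj₁ (Bijection.to φ (a^ n x))

  proper : ∀ {x y} → rotationAdj x y → colour y ≡ not (colour x)
  proper adj = adj-reflection⇒side-flips _ _ (S₂-reflection k₁ k₂ k₃ _ (Equivalence.to (preserves _ _) adj))

  rotate : Fin n → Fin n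
  rotate x = _⊕_ n x k

  start : Fin n
  start = 0 mod n

  closed : iterate rotate start (suc (n / 2 * 2)) ≡ start
  closed = subst (λ m → iterate rotate start m ≡ start) (odd⇒≡1+2q n 2∤n) (iterate-⊕-n k start)
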